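{- Let $G$ be a graph with a skeleton $\mathcal S=(F,D)$, let $H$ be a graph with a map $\chi:V(H)\to V(G)\setminus(F\cup D)$, let $P=P(G,\mathcal S,H,\chi)$, and suppose $G$ contains an odd cycle; let $k$ be the length of a shortest odd cycle in $G$. Then for every cycle $Z$ in $P$ of length $k$, the set $\{v\in V(G)\mid (v,a)$ occurs in $Z$ for some $a\}$ induces a cycle in $G$ of length $k$.
   Context: All graphs are finite, simple, undirected. A homomorphism $G\to H$ is a map with $h(u)h(v)\in E(H)$ whenever $uv\in E(G)$; an embedding is an injective homomorphism; an endomorphism of $G$ is a homomorphism $G\to G$. $G\setminus X$ denotes $G$ with vertex set $X$ deleted. Quotient: for a graph $K$ and $D\subseteq V(K)$ with every vertex of $D$ of degree at most $2$ in $K$, $K/D$ has vertex set $V(K)\setminus D$, distinct $u,v$ adjacent iff $K$ has a $u$–$v$ path with all internal vertices in $D$. A vertex $x\in D$ is associated with a vertex $v$ of $K/D$ if $x$ lies on a path in $K$ between $v$ and some $w\in D$ of degree $1$ in $K$ whose internal vertices are in $D$; $x$ is associated with an edge $vw$ of $K/D$ if $x$ lies on a path in $K$ between $v$ and $w$ with all internal vertices in $D$. Frame: $F\subseteq V(G)$ is a frame if every endomorphism $h$ of $G$ with $F\subseteq h(V(G))$ is surjective. Skeleton: $(F,D)$ with $F$ a frame, $F\cap D=\emptyset$, every $v\in D$ having at most $2$ neighbours outside $F$. "Associated" below refers to $K=G\setminus F$, $K/D=(G\setminus F)/D$. Product graph $P=P(G,\mathcal S,H,\chi)$: $V(P)=V_1\cup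 V_2\cup V_3\cup V_4$ where $V_1=\{(u,a)\mid u\in V(G)\setminus(F\cup D), a\in V(H), \chi(a)=u\}$; $V_2=\{(u,u)\mid u\in F$, or $u\in D$ associated with no vertex and no edge of $(G\setminus F)/D\}$; $V_3=\{(u,\mathbf v_{u,a})\mid u\in D, a\in V(H), u$ associated with the vertex $\chi(a)\}$; $V_4=\{(u,\mathbf v_{u,e})\mid u\in D, e=\{a,b\}\in E(H), u$ associated with the edge $\{\chi(a),\chi(b)\}\}$, with fresh elements $\mathbf v_{u,a},\mathbf v_{u,e}$. Edges (always requiring $uv\in E(G)$): $(u,a)(v,b)$ for both in $V_1$ with $ab\in E(H)$; $(u,a)(v,v)$ for $(u,a)\in V_1$, $(v,v)\in V_2$; $(u,a)(v,\mathbf v_{v,a})$ for $(u,a)\in V_1$, $(v,\mathbf v_{v,a})\in V_3$; $(u,a)(v,\mathbf v_{v,e})$ for $(u,a)\in V_1$, $(v,\mathbf v_{v,e})\in V_4$ with $a\in e$; $(u,u)(v,v)$ for both in $V_2$; $(u,u)(v,z)$ for $(u,u)\in V_2$, $(v,z)\in V_3\cup V_4$; $(u,\mathbf v_{u,a})(v,\mathbf v_{v,a})$ for both in $V_3$; $(u,\mathbf v_{u,e})(v,\mathbf v_{v,e})$ for both in $V_4$; no edges between $V_3$ and $V_4$. -}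

module Defs where

open import Data.Nat using (ℕ; zero; suc; _<_; _≤_; _%_)
open import Data.Fin using (Fin; toℕ; fromℕ; _<_)
  renaming (zero to fzero)
open import Data.Fin.Subset using (Subset; _∈_; _∉_; ∣_∣)
open import Data.Vec using (tabulate; lookup)
open import Data.Bool using (Bool; true; false; T; _∧_; not)
open import Data.Product using (Σ; ∃; _×_; _,_)
open import Data.Sum using (_⊎_)
open import Data.Unit using (⊤)
open import Data.Empty using (⊥)
open import Relation.Nullary using (¬_)
open import Relation.Binary.PropositionalEquality using (_≡_)
open import Function.Bundles using (_⇔_)

record Graph : Set where
  field
    n      : ℕ
    adj    : Fin n → Fin n → Bool
    sym    : ∀ u v → adj u v ≡ adj v u
    irrefl : ∀ u → adj u u ≡ false

open Graph public

E : (G : Graph) → Fin (n G) → Fin (n G) → Set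
E G u v = T (adj G u v)

Injective : {A B : Set} → (A → B) → Set
Injective f = ∀ x y → f x ≡ f y → x ≡ y

Consec : (k : ℕ) → Fin k → Fin k → Set
Consec k i j = (suc (toℕ i) ≡ toℕ j) ⊎ (suc (toℕ i) ≡ k × toℕ j ≡ 0)

IsCycle : {V : Set} → (V → V → Set) → (k : ℕ) → (Fin k → V) → Set
IsCycle R k c = (3 ≤ k) × Injective c × (∀ i j → Consec k i j → R (c i) (c j))

Odd : ℕ → Set
Odd k = k % 2 ≡ 1

ShortestOddCycleLength : Graph → ℕ → Set
ShortestOddCycleLength G k =
  Odd k × (∃ λ (c : Fin k → Fin (n G)) → IsCycle (E G) k c)
  × (∀ k′ → k′ Data.Nat.< k → Odd k′ →
       ¬ (∃ λ (c : Fin k′ → Fin (n G)) → IsCycle (E G) k′ c))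

InducesCycle : (G : Graph) → (k : ℕ) → (Fin (n G) → Set) → Set
InducesCycle G k S =
  (3 ≤ k) × (∃ λ (c : Fin k → Fin (n G)) →
    Injective c
    × (∀ v → S v ⇔ (∃ λ i → c i ≡ v))
    × (∀ i j → E G (c i) (c j) ⇔ (Consec k i j ⊎ Consec k j i)))

Endo : (G : Graph) → (Fin (n G) → Fin (n G)) → Set
Endo G h = ∀ u v → E G u v → E G (h u) (h v)

Surjective : {A B : Set} → (A → B) → Set
Surjective {B = B} f = ∀ (y : B) → ∃ λ x → f x ≡ y

Frame : (G : Graph) → Subset (n G) → Set
Frame G F = ∀ (h : Fin (n G) → Fin (n G)) → Endo G h →
  (∀ x → x ∈ F → ∃ λ y → h y ≡ x) → Surjective h

degK : (G : Graph) → Subset (n G) → Fin (n G) → ℕ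
degK G F w = ∣ tabulate (λ z → adj G w z ∧ not (lookup F z)) ∣

Skeleton : (G : Graph) → Subset (n G) → Subset (n G) → Set
Skeleton G F D =
  Frame G F
  × (∀ x → x ∈ F → x ∉ D)
  × (∀ v → v ∈ D → degK G F v ≤ 2)

PathKD : (G : Graph) → (F D : Subset (n G)) → (v w x : Fin (n G)) → Set
PathKD G F D v w x =
  ∃ λ (len : ℕ) → ∃ λ (p : Fin (suc len) → Fin (n G)) →
    Injective p
    × p fzero ≡ v
    × p (fromℕ len) ≡ w
    × (∀ i → p i ∉ F)
    × (∀ i → 0 Data.Nat.< toℕ i → toℕ i Data.Nat.< len → p i ∈ D)
    × (∀ i j → suc (toℕ i) ≡ toℕ j → E G (p i) (p j))
    × (∃ λ i → p i ≡ x)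

InKD : (G : Graph) → (F D : Subset (n G)) → Fin (n G) → Set
InKD G F D v = v ∉ F × v ∉ D

AssocV : (G : Graph) → (F D : Subset (n G)) → (x v : Fin (n G)) → Set
AssocV G F D x v =
  ∃ λ w → w ∈ D × degK G F w ≡ 1 × PathKD G F D v w x

AssocE : (G : Graph) → (F D : Subset (n G)) → (x v w : Fin (n G)) → Set
AssocE G F D x v w = PathKD G F D v w x

AssocNone : (G : Graph) → (F D : Subset (n G)) → Fin (n G) → Set
AssocNone G F D x =
  ¬ (∃ λ v → InKD G F D v × AssocV G F D x v)
  × ¬ (∃ λ v → ∃ λ w → InKD G F D v × InKD G F D w × AssocE G F D x v w)

module Product (G H : Graph) (F D : Subset (n G)) (χ : Fin (n H) → Fin (n G)) where

  -- Proof components are irrelevant, so equality of vertices is equality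
  -- of the data (u, a), (u, u), (u, v_{u,a}), (u, v_{u,e}).
  -- An edge e = {a,b} of H is represented canonically by (a, b) with a < b.
  data PV : Set where
    v1 : (u : Fin (n G)) (a : Fin (n H)) → .(χ a ≡ u) → PV
    v2 : (u : Fin (n G)) → .(u ∈ F ⊎ (u ∈ D × AssocNone G F D u)) → PV
    v3 : (u : Fin (n G)) (a : Fin (n H)) → .(u ∈ D × AssocV G F D u (χ a)) → PV
    v4 : (u : Fin (n G)) (a b : Fin (n H)) →
         .(u ∈ D × E H a b × a Data.Fin.< b × AssocE G F D u (χ a) (χ b)) → PV

  fst : PV → Fin (n G)
  fst (v1 u _ _)   = u
  fst (v2 u _)     = u
  fst (v3 u _ _)   = u
  fst (v4 u _ _ _) = u

  Compat : PV → PV → Set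
  Compat (v1 _ a _)   (v1 _ b _)    = E H a b
  Compat (v1 _ _ _)   (v2 _ _)      = ⊤
    where open import Data.Unit renaming (⊤ to ⊤)
  Compat (v1 _ a _)   (v3 _ a′ _)   = a ≡ a′
  Compat (v1 _ c _)   (v4 _ a b _)  = c ≡ a ⊎ c ≡ b
  Compat (v2 _ _)     (v1 _ _ _)    = ⊤
    where open import Data.Unit renaming (⊤ to ⊤)
  Compat (v2 _ _)     (v2 _ _)      = ⊤
    where open import Data.Unit renaming (⊤ to ⊤)
  Compat (v2 _ _)     (v3 _ _ _)    = ⊤
    where open import Data.Unit renaming (⊤ to ⊤)
  Compat (v2 _ _)     (v4 _ _ _ _)  = ⊤
    where open import Data.Unit renaming (⊤ to ⊤)
  Compat (v3 _ a′ _)  (v1 _ a _)    = a ≡ a′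
  Compat (v3 _ _ _)   (v2 _ _)      = ⊤
    where open import Data.Unit renaming (⊤ to ⊤)
  Compat (v3 _ a _)   (v3 _ a′ _)   = a ≡ a′
  Compat (v3 _ _ _)   (v4 _ _ _ _)  = ⊥
    where open import Data.Empty renaming (⊥ to ⊥)
  Compat (v4 _ a b _) (v1 _ c _)    = c ≡ a ⊎ c ≡ b
  Compat (v4 _ _ _ _) (v2 _ _)      = ⊤
    where open import Data.Unit renaming (⊤ to ⊤)
  Compat (v4 _ _ _ _) (v3 _ _ _)    = ⊥
    where open import Data.Empty renaming (⊥ to ⊥)
  Compat (v4 _ a b _) (v4 _ a′ b′ _) = a ≡ a′ × b ≡ b′

  PE : PV → PV → Set
  PE x y = E G (fst x) (fst y) × Compat x y

-- The first coordinate maps edges of P to edges of G, so Z projects to a closed walk of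
-- length k in G. If an odd closed walk repeats a vertex, cutting it there gives two shorter
-- closed walks whose lengths add up to the original one, so one of them is odd; an odd
-- closed walk without repetitions is an odd cycle. A chord between non-consecutive vertices
-- likewise cuts the walk into two closed walks, each shorter than k, of total length k + 2,
-- one of which is odd. As G has no odd cycle shorter than k, the projection of Z has neither
-- repeated vertices nor chords: it is an induced k-cycle.

module Submission where

open import Defs hiding (sym)
open import Data.Nat
  using (ℕ; zero; suc; _+_; _∸_; _≤_; _<_; z≤n; s≤s; z<s; _≤?_; _<?_)
open import Data.Nat using (NonZero; >-nonZero⁻¹)
open import Data.Nat.Properties
open import Data.Nat.DivMod
  using (_%_; _mod_; m%n<n; %-distribˡ-+; [m+n]%n≡m%n; m<n⇒m%n≡m; n%n≡0)
open import Data.Nat.Induction using (<-rec)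
open import Data.Nat.Tactic.RingSolver using (solve-∀)
open import Algebra.Properties.CommutativeSemigroup +-commutativeSemigroup using (x∙yz≈y∙xz)
open import Data.Fin using (Fin; toℕ)
import Data.Fin as Fin
open import Data.Fin.Properties using (toℕ-injective; toℕ<n; toℕ-fromℕ<; any?)
import Data.Fin.Properties as Fin
open import Data.Fin.Subset using (Subset; _∉_)
open import Data.Product using (∃; ∃₂; _×_; _,_; proj₁; proj₂)
open import Data.Sum using (_⊎_; inj₁; inj₂; swap)
open import Data.Bool using (T)
open import Relation.Nullary using (¬_; yes; no; contradiction)
open import Relation.Nullary.Decidable using (Dec; _×-dec_)
open import Relation.Binary using (DecidableEquality; tri<; tri≈; tri>)
open import Relation.Binary.PropositionalEquality
  using (_≡_; _≢_; refl; sym; trans; cong; cong₂; subst; subst₂; module ≡-Reasoning)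
open import Function using (_∘′_; id)
open import Function.Bundles using (mk⇔)

open ≡-Reasoning

even-or-odd : ∀ m → m % 2 ≡ 0 ⊎ Odd m
even-or-odd m with m % 2 | m%n<n m 2
... | 0           | _               = inj₁ refl
... | 1           | _               = inj₂ refl
... | suc (suc _) | s≤s (s≤s ())

odd-summand : ∀ m n → Odd (m + n) → Odd m ⊎ Odd n
odd-summand m n odd-m+n with even-or-odd m | even-or-odd n
... | inj₂ odd-m | _          = inj₁ odd-m
... | inj₁ _     | inj₂ odd-n = inj₂ odd-n
... | inj₁ even-m | inj₁ even-n = contradiction (trans (sym odd-m+n) even-m+n) λ ()
  where
  even-m+n : (m + n) % 2 ≡ 0
  even-m+n = begin
    (m + n) % 2           ≡⟨ %-distribˡ-+ m n 2 ⟩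
    (m % 2 + n % 2) % 2   ≡⟨ cong₂ (λ x y → (x + y) % 2) even-m even-n ⟩
    0                     ∎

odd-+2 : ∀ m → Odd m → Odd (m + 2)
odd-+2 m = trans ([m+n]%n≡m%n m 2)

odd⇒3≤ : ∀ m → Odd m → m ≢ 1 → 3 ≤ m
odd⇒3≤ 1 _ m≢1 = contradiction refl m≢1
odd⇒3≤ (suc (suc (suc _))) _ _ = s≤s (s≤s (s≤s z≤n))

<-<-decompose : ∀ {i j m} → i < j → j < m →
  ∃₂ λ a b → j ≡ i + suc a × m ≡ i + (suc a + suc b)
<-<-decompose {i} i<j j<m
  with a , refl ← m≤n⇒∃[o]m+o≡n i<j | b , refl ← m≤n⇒∃[o]m+o≡n j<m =
  a , b , sym (+-suc i a) , rearrange i a b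
  where
  rearrange : ∀ i a b → suc (suc i + a) + b ≡ i + (suc a + suc b)
  rearrange = solve-∀

repeat-lengths : ∀ i a b → 0 < a → 0 < b → a < i + (a + b) × i + b < i + (a + b)
repeat-lengths i a b 0<a 0<b =
  <-≤-trans (m<m+n a 0<b) (m≤n+m (a + b) i) , +-monoʳ-< i (m<n+m b 0<a)

chord-lengths : ∀ i a b → 1 < a → 1 < i + b →
  a + 1 < i + (a + b) × i + 1 + b < i + (a + b)
chord-lengths i a b 1<a 1<i+b =
  subst (a + 1 <_) (x∙yz≈y∙xz a i b) (+-monoʳ-< a 1<i+b) ,
  subst (_< i + (a + b)) (sym (+-assoc i 1 b)) (+-monoʳ-< i (+-monoˡ-< b 1<a))

module Walks {V : Set} (R : V → V → Set) where

  -- A walk of length m is the sequence w 0, …, w m; the values of w beyond m are junk.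
  IsWalk : ℕ → (ℕ → V) → Set
  IsWalk m w = ∀ t → t < m → R (w t) (w (suc t))

  IsClosedWalk : ℕ → (ℕ → V) → Set
  IsClosedWalk m w = IsWalk m w × w m ≡ w 0

  OddClosedWalkBelow : ℕ → Set
  OddClosedWalkBelow m = ∃ λ m′ → m′ < m × Odd m′ × ∃ λ w → IsClosedWalk m′ w

  HasRepeat : (m : ℕ) → (ℕ → V) → Set
  HasRepeat m w = ∃₂ λ (i j : Fin m) → i Fin.< j × w (toℕ i) ≡ w (toℕ j)

  hasRepeat? : DecidableEquality V → ∀ m w → Dec (HasRepeat m w)
  hasRepeat? _≟_ m w =
    any? λ i → any? λ j → (i Fin.<? j) ×-dec (w (toℕ i) ≟ w (toℕ j))

  step : V → V → ℕ → V
  step x y zero    = x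
  step x y (suc _) = y

  _⟨_⟩++_ : (ℕ → V) → ℕ → (ℕ → V) → ℕ → V
  (u ⟨ a ⟩++ v) t with t ≤? a
  ... | yes _ = u t
  ... | no _  = v (t ∸ a)

  infixr 5 _⟨_⟩++_

  ++-left : ∀ {u v a t} → t ≤ a → (u ⟨ a ⟩++ v) t ≡ u t
  ++-left {a = a} {t} t≤a with t ≤? a
  ... | yes _   = refl
  ... | no t≰a = contradiction t≤a t≰a

  ++-right : ∀ {u v a t} → u a ≡ v 0 → a ≤ t → (u ⟨ a ⟩++ v) t ≡ v (t ∸ a)
  ++-right {u} {v} {a} {t} link a≤t with t ≤? a
  ... | no _    = refl
  ... | yes t≤a = begin
    u t        ≡⟨ cong u (≤-antisym t≤a a≤t) ⟩
    u a        ≡⟨ link ⟩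
    v 0        ≡⟨ cong v (sym (m≤n⇒m∸n≡0 t≤a)) ⟩
    v (t ∸ a)  ∎

  ++-start : ∀ u v a → (u ⟨ a ⟩++ v) 0 ≡ u 0
  ++-start u v a = ++-left {u} {v} {a} z≤n

  ++-end : ∀ {u v} a b → u a ≡ v 0 → (u ⟨ a ⟩++ v) (a + b) ≡ v b
  ++-end {v = v} a b link = trans (++-right link (m≤m+n a b)) (cong v (m+n∸m≡n a b))

  step-walk : ∀ {x y} → R x y → IsWalk 1 (step x y)
  step-walk r zero _ = r
  step-walk r (suc _) (s≤s ())

  take-walk : ∀ {m m′ w} → m ≤ m′ → IsWalk m′ w → IsWalk m w
  take-walk m≤m′ walk t t<m = walk t (<-≤-trans t<m m≤m′)

  drop-walk : ∀ {m w} i → IsWalk (i + m) w → IsWalk m (λ t → w (i + t))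
  drop-walk {w = w} i walk t t<m =
    subst (R (w (i + t)) ∘′ w) (sym (+-suc i t)) (walk (i + t) (+-monoʳ-< i t<m))

  ++-walk : ∀ {u v a b} → IsWalk a u → IsWalk b v → u a ≡ v 0 →
    IsWalk (a + b) (u ⟨ a ⟩++ v)
  ++-walk {u} {v} {a} {b} walk-u walk-v link t t<a+b = edge (t <? a)
    where
    edge : Dec (t < a) → R ((u ⟨ a ⟩++ v) t) ((u ⟨ a ⟩++ v) (suc t))
    edge (yes t<a) = subst₂ R (sym (++-left (<⇒≤ t<a))) (sym (++-left t<a)) (walk-u t t<a)
    edge (no t≮a)  =
      subst₂ R (sym (++-right link a≤t)) (sym (++-right link (m≤n⇒m≤1+n a≤t)))
        (subst (R (v (t ∸ a)) ∘′ v) (sym (+-∸-assoc 1 a≤t)) (walk-v (t ∸ a) t∸a<b))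
      where
      a≤t : a ≤ t
      a≤t = ≮⇒≥ t≮a
      t∸a<b : t ∸ a < b
      t∸a<b = subst (t ∸ a <_) (m+n∸m≡n a b) (∸-monoˡ-< t<a+b a≤t)

  repeat-split : ∀ {w} i a b → IsClosedWalk (i + (a + b)) w → w i ≡ w (i + a) →
    IsClosedWalk a (λ t → w (i + t))
    × IsClosedWalk (i + b) (w ⟨ i ⟩++ λ t → w (i + a + t))
  repeat-split {w} i a b (walk , closed) repeat = loop , rest
    where
    walk′ : IsWalk (i + a + b) w
    walk′ = subst (λ m → IsWalk m w) (sym (+-assoc i a b)) walk
    suffix : ℕ → V
    suffix t = w (i + a + t)
    link : w i ≡ suffix 0
    link = trans repeat (cong w (sym (+-identityʳ (i + a))))
    loop : IsClosedWalk a (λ t → w (i + t))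
    loop = drop-walk i (take-walk (m≤m+n (i + a) b) walk′)
         , trans (sym repeat) (cong w (sym (+-identityʳ i)))
    rest : IsClosedWalk (i + b) (w ⟨ i ⟩++ suffix)
    rest = ++-walk (take-walk (m≤m+n i (a + b)) walk) (drop-walk (i + a) walk′) link
         , (begin
             (w ⟨ i ⟩++ suffix) (i + b)  ≡⟨ ++-end i b link ⟩
             w (i + a + b)               ≡⟨ cong w (+-assoc i a b) ⟩
             w (i + (a + b))             ≡⟨ closed ⟩
             w 0                         ≡⟨ ++-start w suffix i ⟨
             (w ⟨ i ⟩++ suffix) 0        ∎)

  chord-split : ∀ {w} i a b → IsClosedWalk (i + (a + b)) w →
    R (w i) (w (i + a)) → R (w (i + a)) (w i) →
    IsClosedWalk (a + 1) ((λ t → w (i + t)) ⟨ a ⟩++ step (w (i + a)) (w i))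
    × IsClosedWalk (i + 1 + b)
        ((w ⟨ i ⟩++ step (w i) (w (i + a))) ⟨ i + 1 ⟩++ λ t → w (i + a + t))
  chord-split {w} i a b (walk , closed) forth back = loop , rest
    where
    walk′ : IsWalk (i + a + b) w
    walk′ = subst (λ m → IsWalk m w) (sym (+-assoc i a b)) walk
    segment back-step forth-step detour suffix : ℕ → V
    segment t = w (i + t)
    back-step = step (w (i + a)) (w i)
    forth-step = step (w i) (w (i + a))
    detour = w ⟨ i ⟩++ forth-step
    suffix t = w (i + a + t)
    loop : IsClosedWalk (a + 1) (segment ⟨ a ⟩++ back-step)
    loop = ++-walk (drop-walk i (take-walk (m≤m+n (i + a) b) walk′)) (step-walk back) refl
         , (begin
             (segment ⟨ a ⟩++ back-step) (a + 1)  ≡⟨ ++-end a 1 refl ⟩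
             w i                                  ≡⟨ cong w (+-identityʳ i) ⟨
             w (i + 0)                            ≡⟨ ++-start segment back-step a ⟨
             (segment ⟨ a ⟩++ back-step) 0        ∎)
    link : detour (i + 1) ≡ suffix 0
    link = trans (++-end i 1 refl) (cong w (sym (+-identityʳ (i + a))))
    rest : IsClosedWalk (i + 1 + b) (detour ⟨ i + 1 ⟩++ suffix)
    rest = ++-walk (++-walk (take-walk (m≤m+n i (a + b)) walk) (step-walk forth) refl)
                   (drop-walk (i + a) walk′) link
         , (begin
             (detour ⟨ i + 1 ⟩++ suffix) (i + 1 + b)  ≡⟨ ++-end (i + 1) b link ⟩
             w (i + a + b)                            ≡⟨ cong w (+-assoc i a b) ⟩
             w (i + (a + b))                          ≡⟨ closed ⟩
             w 0                                      ≡⟨ ++-start w forth-step i ⟨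
             detour 0                                 ≡⟨ ++-start detour suffix (i + 1) ⟨
             (detour ⟨ i + 1 ⟩++ suffix) 0            ∎)

  injective-of-¬HasRepeat : ∀ {m w} → ¬ HasRepeat m w →
    Injective (λ (i : Fin m) → w (toℕ i))
  injective-of-¬HasRepeat ¬repeat i j eq with <-cmp (toℕ i) (toℕ j)
  ... | tri< i<j _ _ = contradiction (i , j , i<j , eq) ¬repeat
  ... | tri≈ _ i≡j _ = toℕ-injective i≡j
  ... | tri> _ _ j<i = contradiction (j , i , j<i , sym eq) ¬repeat

  cycle-of-closedWalk : ∀ {m w} → 3 ≤ m → IsClosedWalk m w → ¬ HasRepeat m w →
    IsCycle R m (λ i → w (toℕ i))
  cycle-of-closedWalk {m} {w} 3≤m (walk , closed) ¬repeat =
    3≤m , injective-of-¬HasRepeat {w = w} ¬repeat , edge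
    where
    edge : ∀ i j → Consec m i j → R (w (toℕ i)) (w (toℕ j))
    edge i j (inj₁ next) = subst (R _ ∘′ w) next (walk (toℕ i) (toℕ<n i))
    edge i j (inj₂ (last , first)) = subst (R _) wrap (walk (toℕ i) (toℕ<n i))
      where
      wrap : w (suc (toℕ i)) ≡ w (toℕ j)
      wrap = trans (cong w last) (trans closed (cong w (sym first)))

  toℕ-mod : ∀ {k t} .{{_ : NonZero k}} → t < k → toℕ (t mod k) ≡ t
  toℕ-mod t<k = trans (toℕ-fromℕ< _) (m<n⇒m%n≡m t<k)

  closedWalk-of-cyclic : ∀ {k} .{{_ : NonZero k}} (c : Fin k → V) →
    (∀ i j → Consec k i j → R (c i) (c j)) → IsClosedWalk k (λ t → c (t mod k))
  closedWalk-of-cyclic {k} c edge = walk , cong c (toℕ-injective end≡start)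
    where
    end≡start : toℕ (k mod k) ≡ toℕ (0 mod k)
    end≡start = trans (toℕ-fromℕ< _) (trans (n%n≡0 k) (sym (toℕ-mod (>-nonZero⁻¹ k))))
    walk : IsWalk k (λ t → c (t mod k))
    walk t t<k = edge _ _ (consec (suc t <? k))
      where
      consec : Dec (suc t < k) → Consec k (t mod k) (suc t mod k)
      consec (yes t+1<k) = inj₁ (trans (cong suc (toℕ-mod t<k)) (sym (toℕ-mod t+1<k)))
      consec (no t+1≮k)  = inj₂ (trans (cong suc (toℕ-mod t<k)) t+1≡k , wraps)
        where
        t+1≡k : suc t ≡ k
        t+1≡k = ≤-antisym t<k (≮⇒≥ t+1≮k)
        wraps : toℕ (suc t mod k) ≡ 0
        wraps = trans (toℕ-fromℕ< _) (trans (cong (_% k) t+1≡k) (n%n≡0 k))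

  odd-split : ∀ {m x y u v} → Odd (x + y) → x < m → y < m →
    IsClosedWalk x u → IsClosedWalk y v → OddClosedWalkBelow m
  odd-split {x = x} {y} odd x<m y<m closed-u closed-v with odd-summand x y odd
  ... | inj₁ odd-x = x , x<m , odd-x , _ , closed-u
  ... | inj₂ odd-y = y , y<m , odd-y , _ , closed-v

  repeat⇒shorter-odd : ∀ {w} i a b → 0 < a → 0 < b →
    Odd (i + (a + b)) → IsClosedWalk (i + (a + b)) w →
    w i ≡ w (i + a) → OddClosedWalkBelow (i + (a + b))
  repeat⇒shorter-odd i a b 0<a 0<b odd closed repeat =
    let loop , rest = repeat-split i a b closed repeat
        a<m , i+b<m = repeat-lengths i a b 0<a 0<b
    in  odd-split (subst Odd (x∙yz≈y∙xz i a b) odd) a<m i+b<m loop rest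

  hasRepeat⇒shorter-odd : ∀ {m w} → Odd m → IsClosedWalk m w → HasRepeat m w →
    OddClosedWalkBelow m
  hasRepeat⇒shorter-odd {m} {w} odd closed (i , j , i<j , repeat)
    with a , b , j≡ , m≡ ← <-<-decompose i<j (toℕ<n j) =
    subst OddClosedWalkBelow (sym m≡)
      (repeat⇒shorter-odd (toℕ i) (suc a) (suc b) z<s z<s
        (subst Odd m≡ odd) (subst (λ m → IsClosedWalk m w) m≡ closed)
        (trans repeat (cong w j≡)))

  chord⇒shorter-odd : ∀ {w} i a b → 1 < a → 1 < i + b →
    Odd (i + (a + b)) → IsClosedWalk (i + (a + b)) w →
    R (w i) (w (i + a)) → R (w (i + a)) (w i) → OddClosedWalkBelow (i + (a + b))
  chord⇒shorter-odd i a b 1<a 1<i+b odd closed forth back =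
    let loop , rest = chord-split i a b closed forth back
        a+1<m , i+1+b<m = chord-lengths i a b 1<a 1<i+b
        odd-sum     = subst Odd (lengths-sum i a b) (odd-+2 (i + (a + b)) odd)
    in  odd-split odd-sum a+1<m i+1+b<m loop rest
    where
    lengths-sum : ∀ i a b → i + (a + b) + 2 ≡ (a + 1) + (i + 1 + b)
    lengths-sum = solve-∀

module OddCycles (G : Graph) where
  open Walks (E G)

  E-irrefl : ∀ {u} → ¬ E G u u
  E-irrefl {u} = subst T (irrefl G u)

  E-sym : ∀ {u v} → E G u v → E G v u
  E-sym {u} {v} = subst T (Graph.sym G u v)

  ¬closedWalk-of-length-1 : ∀ {w} → ¬ IsClosedWalk 1 w
  ¬closedWalk-of-length-1 {w} (walk , closed) = E-irrefl (subst (E G (w 0)) closed (walk 0 z<s))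

  OddCycleOfLengthAtMost : ℕ → Set
  OddCycleOfLengthAtMost m =
    ∃ λ m′ → m′ ≤ m × Odd m′ × ∃ λ c → IsCycle (E G) m′ c

  odd-closedWalk⇒odd-cycle : ∀ m {w} → Odd m → IsClosedWalk m w → OddCycleOfLengthAtMost m
  odd-closedWalk⇒odd-cycle = <-rec P extract
    where
    P : ℕ → Set
    P m = ∀ {w} → Odd m → IsClosedWalk m w → OddCycleOfLengthAtMost m
    extract : ∀ m → (∀ {m′} → m′ < m → P m′) → P m
    extract m shorter {w} odd closed with hasRepeat? Fin._≟_ m w
    ... | no ¬repeat =
      m , ≤-refl , odd , _ , cycle-of-closedWalk (odd⇒3≤ m odd m≢1) closed ¬repeat
      where
      m≢1 : m ≢ 1
      m≢1 refl = ¬closedWalk-of-length-1 closed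
    ... | yes repeat =
      let m′ , m′<m , odd′ , _ , closed′ = hasRepeat⇒shorter-odd odd closed repeat
          m″ , m″≤m′ , cycle = shorter m′<m odd′ closed′
      in  m″ , ≤-trans m″≤m′ (<⇒≤ m′<m) , cycle

  shortest-chord-is-cycle-edge : ∀ {w} i a b → ¬ OddClosedWalkBelow (i + (suc a + suc b)) →
    Odd (i + (suc a + suc b)) → IsClosedWalk (i + (suc a + suc b)) w →
    E G (w i) (w (i + suc a)) → a ≡ 0 ⊎ (i ≡ 0 × b ≡ 0)
  shortest-chord-is-cycle-edge i       zero    b       _ _ _ _ = inj₁ refl
  shortest-chord-is-cycle-edge zero    (suc a) zero    _ _ _ _ = inj₂ (refl , refl)
  shortest-chord-is-cycle-edge zero    (suc a) (suc b) ¬shorter odd closed chord =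
    contradiction (chord⇒shorter-odd 0 _ _ (s≤s (s≤s z≤n)) (s≤s (s≤s z≤n))
                     odd closed chord (E-sym chord)) ¬shorter
  shortest-chord-is-cycle-edge (suc i) (suc a) b       ¬shorter odd closed chord =
    contradiction (chord⇒shorter-odd (suc i) _ _ (s≤s (s≤s z≤n)) 1<i+b
                     odd closed chord (E-sym chord)) ¬shorter
    where
    1<i+b : 1 < suc i + suc b
    1<i+b = s≤s (subst (1 ≤_) (sym (+-suc i b)) (s≤s z≤n))

  module _ {k} (shortest : ShortestOddCycleLength G k) where

    ¬oddClosedWalkBelow : ¬ OddClosedWalkBelow k
    ¬oddClosedWalkBelow (m , m<k , odd , _ , closed) =
      let m′ , m′≤m , odd′ , cycle = odd-closedWalk⇒odd-cycle m odd closed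
      in  proj₂ (proj₂ shortest) m′ (≤-<-trans m′≤m m<k) odd′ cycle

    shortest-¬HasRepeat : ∀ {w} → IsClosedWalk k w → ¬ HasRepeat k w
    shortest-¬HasRepeat closed =
      ¬oddClosedWalkBelow ∘′ hasRepeat⇒shorter-odd (proj₁ shortest) closed

    shortest-chordless : ∀ {w} → IsClosedWalk k w → (i j : Fin k) → i Fin.< j →
      E G (w (toℕ i)) (w (toℕ j)) → Consec k i j ⊎ Consec k j i
    shortest-chordless {w} closed i j i<j chord
      with a , b , j≡ , k≡ ← <-<-decompose i<j (toℕ<n j)
      with shortest-chord-is-cycle-edge (toℕ i) a b
             (¬oddClosedWalkBelow ∘′ subst OddClosedWalkBelow (sym k≡))
             (subst Odd k≡ (proj₁ shortest)) (subst (λ m → IsClosedWalk m w) k≡ closed)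
             (subst (E G _ ∘′ w) j≡ chord)
    ... | inj₁ refl = inj₁ (inj₁ (trans (+-comm 1 (toℕ i)) (sym j≡)))
    ... | inj₂ (i≡0 , refl) = inj₂ (inj₂ (sym k≡suc-j , i≡0))
      where
      k≡suc-j : k ≡ suc (toℕ j)
      k≡suc-j = begin
        k                        ≡⟨ k≡ ⟩
        toℕ i + (suc a + 1)      ≡⟨ cong (toℕ i +_) (+-comm (suc a) 1) ⟩
        toℕ i + suc (suc a)      ≡⟨ +-suc (toℕ i) (suc a) ⟩
        suc (toℕ i + suc a)      ≡⟨ cong suc j≡ ⟨
        suc (toℕ j)              ∎

  shortest-odd-cyclic-map-induces-cycle : ∀ {k} → ShortestOddCycleLength G k →
    (c : Fin k → Fin (n G)) → (∀ i j → Consec k i j → E G (c i) (c j)) →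
    InducesCycle G k (λ v → ∃ λ i → c i ≡ v)
  -- There is no clause for k = 0: Odd 0 computes to 0 ≡ 1.
  shortest-odd-cyclic-map-induces-cycle {suc k′} shortest@(_ , (_ , 3≤k , _) , _) c edge =
    3≤k , c , injective , (λ _ → mk⇔ id id) ,
    λ i j → mk⇔ (adjacent⇒consec i j) (consec⇒adjacent i j)
    where
    k = suc k′
    w : ℕ → Fin (n G)
    w t = c (t mod k)
    closed : IsClosedWalk k w
    closed = closedWalk-of-cyclic c edge
    w-toℕ : ∀ i → w (toℕ i) ≡ c i
    w-toℕ i = cong c (toℕ-injective (toℕ-mod (toℕ<n i)))
    injective : Injective c
    injective i j eq = injective-of-¬HasRepeat {w = w} (shortest-¬HasRepeat shortest closed) i j
      (trans (w-toℕ i) (trans eq (sym (w-toℕ j))))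
    consec⇒adjacent : ∀ i j → Consec k i j ⊎ Consec k j i → E G (c i) (c j)
    consec⇒adjacent i j (inj₁ i→j) = edge i j i→j
    consec⇒adjacent i j (inj₂ j→i) = E-sym (edge j i j→i)
    chord : ∀ i j → i Fin.< j → E G (c i) (c j) → Consec k i j ⊎ Consec k j i
    chord i j i<j = shortest-chordless shortest closed i j i<j
                  ∘′ subst₂ (E G) (sym (w-toℕ i)) (sym (w-toℕ j))
    adjacent⇒consec : ∀ i j → E G (c i) (c j) → Consec k i j ⊎ Consec k j i
    adjacent⇒consec i j adj with <-cmp (toℕ i) (toℕ j)
    ... | tri< i<j _ _ = chord i j i<j adj
    ... | tri≈ _ i≡j _ =
      contradiction (subst (E G (c i) ∘′ c) (sym (toℕ-injective i≡j)) adj) E-irrefl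
    ... | tri> _ _ j<i = swap (chord j i j<i (E-sym adj))

lemma5p17 : (G : Graph) (F D : Subset (n G)) → Skeleton G F D →
    (H : Graph) (χ : Fin (n H) → Fin (n G)) →
    (∀ a → χ a ∉ F × χ a ∉ D) →
    (k : ℕ) → ShortestOddCycleLength G k →
    (Z : Fin k → Product.PV G H F D χ) →
    IsCycle (Product.PE G H F D χ) k Z →
    InducesCycle G k (λ v → ∃ λ i → Product.fst G H F D χ (Z i) ≡ v)
lemma5p17 G F D _ H χ _ k shortest Z (_ , _ , edge) =
  OddCycles.shortest-odd-cyclic-map-induces-cycle G shortest (fst ∘′ Z)
    (λ i j → proj₁ ∘′ edge i j)
  where open Product G H F D χ using (fst)
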